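{- For all $n \ge 2$, $D_n$ is $1$-saturated and $2$-saturated, but $D_n$ is not $i$-saturated for any $i \in \{3,\dots,n\}$.
   Context: $e_1,\dots,e_n$ is the standard basis of $\mathbb{Z}_3^n$. A set $U \subseteq \mathbb{Z}_3^n$ is $i$-saturated if $U \cap \{x, x+e_i, x+2e_i\} \ne \emptyset$ for all $x \in \mathbb{Z}_3^n$. $A_n = \{x \in \mathbb{Z}_3^n : \sum_i x_i \equiv 0 \pmod 3\}$. For $S \subseteq \mathbb{Z}_3^{n}$ and $c \in \mathbb{Z}_3$, $(S,c) = \{(x_1,\dots,x_{n},c) : (x_1,\dots,x_n) \in S\}$. The sets $D_n$ are defined by $D_1 = \{1,2\}$ and $D_{n+1} = (D_n,0) \cup (A_n,1) \cup (A_n,2)$. -}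

module Defs where

open import Data.Nat using (ℕ; zero; suc)
open import Data.Fin using (Fin; zero; suc; fromℕ; inject₁)
open import Data.Product using (∃; _×_; _,_)
open import Data.Sum using (_⊎_)
open import Data.Empty using (⊥)
open import Data.Unit using (⊤)
open import Relation.Binary.PropositionalEquality using (_≡_; _≢_)
open import Relation.Nullary using (¬_)

Z3 : Set
Z3 = Fin 3

_+₃_ : Z3 → Z3 → Z3
zero +₃ b = b
suc zero +₃ zero = suc zero
suc zero +₃ suc zero = suc (suc zero)
suc zero +₃ suc (suc zero) = zero
suc (suc zero) +₃ zero = suc (suc zero)
suc (suc zero) +₃ suc zero = zero
suc (suc zero) +₃ suc (suc zero) = suc zero

-- elements of ℤ₃ⁿ as functions Fin n → Z3; coordinate k (1-based) is index k-1
Vec3 : ℕ → Set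
Vec3 n = Fin n → Z3

Subset3 : ℕ → Set₁
Subset3 n = Vec3 n → Set

addAt : ∀ {n} → Vec3 n → Fin n → Z3 → Vec3 n
addAt {suc n} x zero c zero = x zero +₃ c
addAt {suc n} x zero c (suc j) = x (suc j)
addAt {suc n} x (suc i) c zero = x zero
addAt {suc n} x (suc i) c (suc j) = addAt (λ k → x (suc k)) i c j

one₃ two₃ : Z3
one₃ = suc zero
two₃ = suc (suc zero)

Saturated : ∀ {n} → Subset3 n → Fin n → Set
Saturated U i = ∀ x → U x ⊎ (U (addAt x i one₃) ⊎ U (addAt x i two₃))

sum3 : ∀ {n} → Vec3 n → Z3
sum3 {zero} x = zero
sum3 {suc n} x = x zero +₃ sum3 (λ k → x (suc k))

A : (n : ℕ) → Subset3 n
A n x = sum3 x ≡ zero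

-- D_1 = {1,2};  D_{n+1} = (D_n,0) ∪ (A_n,1) ∪ (A_n,2)
-- Dset m is D_{m+1} ⊆ ℤ₃^{m+1}; the appended coordinate is the last one (index fromℕ).
Dset : (m : ℕ) → Subset3 (suc m)
Dset zero x = x zero ≢ zero
Dset (suc m) x =
  (Dset m (λ k → x (inject₁ k)) × x (fromℕ (suc m)) ≡ zero)
  ⊎ ((A (suc m) (λ k → x (inject₁ k)) × x (fromℕ (suc m)) ≡ one₃)
  ⊎ (A (suc m) (λ k → x (inject₁ k)) × x (fromℕ (suc m)) ≡ two₃))

-- D_n for n ≥ 1 (D_0 is not defined in the paper; we set it empty, it is never used)
Dn : (n : ℕ) → Subset3 n
Dn zero _ = ⊥
Dn (suc m) = Dset m

-- Split U ⊆ ℤ₃ⁿ⁺¹ into its slices U_t = {y ∈ ℤ₃ⁿ : (y,t) ∈ U}. A line in direction e_i with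
-- i ≤ n stays inside one slice, so U is i-saturated iff every slice is; a line in direction
-- e_{n+1} meets every slice once, so U is (n+1)-saturated iff the slices cover ℤ₃ⁿ.
-- The slices of D_{n+1} are D_n, A_n, A_n, and A_n is saturated in every direction because a
-- step along e_i shifts the coordinate sum. Hence D_{n+1} is i-saturated iff D_n is (i ≤ n),
-- and (n+1)-saturated iff D_n ∪ A_n = ℤ₃ⁿ. This holds for n = 1 (D_1 = {1,2}, A_1 = {0}), and
-- D_1 = {1,2} is 1-saturated. For n ≥ 2 the point (0,…,0,1,1) lies neither in A_n nor in D_n,
-- since its last coordinate 1 would force (0,…,0,1) ∈ A_{n-1}.

module Submission where

open import Defs
open import Data.Nat using (ℕ; suc; _≤_; s≤s)
open import Data.Fin using (Fin; zero; suc; toℕ; fromℕ; inject₁)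
open import Data.Fin.Properties using (toℕ-inject₁; 0≢1+n)
open import Data.Fin.Relation.Unary.Top using (view; ‵fromℕ; ‵inject₁)
open import Data.Vec.Functional using (init; last; insertAt; replicate)
open import Data.Vec.Functional.Properties using (insertAt-lookup)
open import Data.Product using (_×_; _,_)
open import Data.Sum as Sum using (_⊎_; inj₁; inj₂; [_,_]′)
open import Function using (_∘_; id; _⇔_; mk⇔; Equivalence)
open import Relation.Binary.Definitions using (_Respects_)
open import Relation.Binary.PropositionalEquality
open import Relation.Nullary using (¬_; contradiction)
open import Relation.Unary using (_⊆_; _∪_; ⋃; Universal)

open Equivalence using (to; from)

+₃-identityʳ : ∀ a → a +₃ zero ≡ a
+₃-identityʳ zero             = refl
+₃-identityʳ (suc zero)       = refl
+₃-identityʳ (suc (suc zero)) = refl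

+₃-comm : ∀ a b → a +₃ b ≡ b +₃ a
+₃-comm zero             b                = sym (+₃-identityʳ b)
+₃-comm a                zero             = +₃-identityʳ a
+₃-comm (suc zero)       (suc zero)       = refl
+₃-comm (suc zero)       (suc (suc zero)) = refl
+₃-comm (suc (suc zero)) (suc zero)       = refl
+₃-comm (suc (suc zero)) (suc (suc zero)) = refl

+₃-assoc : ∀ a b c → (a +₃ b) +₃ c ≡ a +₃ (b +₃ c)
+₃-assoc zero             b                c                = refl
+₃-assoc (suc zero)       zero             c                = refl
+₃-assoc (suc zero)       (suc zero)       zero             = refl
+₃-assoc (suc zero)       (suc zero)       (suc zero)       = refl
+₃-assoc (suc zero)       (suc zero)       (suc (suc zero)) = refl
+₃-assoc (suc zero)       (suc (suc zero)) zero             = refl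
+₃-assoc (suc zero)       (suc (suc zero)) (suc zero)       = refl
+₃-assoc (suc zero)       (suc (suc zero)) (suc (suc zero)) = refl
+₃-assoc (suc (suc zero)) zero             c                = refl
+₃-assoc (suc (suc zero)) (suc zero)       zero             = refl
+₃-assoc (suc (suc zero)) (suc zero)       (suc zero)       = refl
+₃-assoc (suc (suc zero)) (suc zero)       (suc (suc zero)) = refl
+₃-assoc (suc (suc zero)) (suc (suc zero)) zero             = refl
+₃-assoc (suc (suc zero)) (suc (suc zero)) (suc zero)       = refl
+₃-assoc (suc (suc zero)) (suc (suc zero)) (suc (suc zero)) = refl

+₃-reach : ∀ s t → t ≡ s ⊎ (t ≡ s +₃ one₃ ⊎ t ≡ s +₃ two₃)
+₃-reach zero             zero             = inj₁ refl
+₃-reach zero             (suc zero)       = inj₂ (inj₁ refl)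
+₃-reach zero             (suc (suc zero)) = inj₂ (inj₂ refl)
+₃-reach (suc zero)       zero             = inj₂ (inj₂ refl)
+₃-reach (suc zero)       (suc zero)       = inj₁ refl
+₃-reach (suc zero)       (suc (suc zero)) = inj₂ (inj₁ refl)
+₃-reach (suc (suc zero)) zero             = inj₂ (inj₁ refl)
+₃-reach (suc (suc zero)) (suc zero)       = inj₂ (inj₂ refl)
+₃-reach (suc (suc zero)) (suc (suc zero)) = inj₁ refl

infixl 5 _∷ʳ_

_∷ʳ_ : ∀ {n} → Vec3 n → Z3 → Vec3 (suc n)
xs ∷ʳ v = insertAt xs (fromℕ _) v

init-∷ʳ : ∀ {n} (xs : Vec3 n) v → init (xs ∷ʳ v) ≗ xs
init-∷ʳ {suc n} xs v zero    = refl
init-∷ʳ {suc n} xs v (suc k) = init-∷ʳ (xs ∘ suc) v k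

last-∷ʳ : ∀ {n} (xs : Vec3 n) v → last (xs ∷ʳ v) ≡ v
last-∷ʳ xs = insertAt-lookup xs (fromℕ _)

init-∷ʳ-last : ∀ {n} (x : Vec3 (suc n)) → init x ∷ʳ last x ≗ x
init-∷ʳ-last {ℕ.zero} x zero    = refl
init-∷ʳ-last {suc n}  x zero    = refl
init-∷ʳ-last {suc n}  x (suc k) = init-∷ʳ-last (x ∘ suc) k

addAt-cong : ∀ {n} {x y : Vec3 n} i c → x ≗ y → addAt x i c ≗ addAt y i c
addAt-cong {suc n} zero    c x≗y zero    = cong (_+₃ c) (x≗y zero)
addAt-cong {suc n} zero    c x≗y (suc k) = x≗y (suc k)
addAt-cong {suc n} (suc i) c x≗y zero    = x≗y zero
addAt-cong {suc n} (suc i) c x≗y (suc k) = addAt-cong i c (x≗y ∘ suc) k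

addAt-∷ʳ-inject₁ : ∀ {n} (xs : Vec3 n) v i c →
  addAt (xs ∷ʳ v) (inject₁ i) c ≗ addAt xs i c ∷ʳ v
addAt-∷ʳ-inject₁ {suc n} xs v zero    c zero    = refl
addAt-∷ʳ-inject₁ {suc n} xs v zero    c (suc k) = refl
addAt-∷ʳ-inject₁ {suc n} xs v (suc i) c zero    = refl
addAt-∷ʳ-inject₁ {suc n} xs v (suc i) c (suc k) = addAt-∷ʳ-inject₁ (xs ∘ suc) v i c k

addAt-∷ʳ-last : ∀ {n} (xs : Vec3 n) v c → addAt (xs ∷ʳ v) (fromℕ n) c ≗ xs ∷ʳ (v +₃ c)
addAt-∷ʳ-last {ℕ.zero} xs v c zero    = refl
addAt-∷ʳ-last {suc n}  xs v c zero    = refl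
addAt-∷ʳ-last {suc n}  xs v c (suc k) = addAt-∷ʳ-last (xs ∘ suc) v c k

Slice : ∀ {n} → Subset3 (suc n) → Z3 → Subset3 n
Slice U t y = U (y ∷ʳ t)

saturated-mono : ∀ {n} {U V : Subset3 n} i → U ⊆ V → Saturated U i → Saturated V i
saturated-mono i U⊆V sat x = Sum.map U⊆V (Sum.map U⊆V U⊆V) (sat x)

module _ {n} {U : Subset3 (suc n)} (U-resp : U Respects _≗_) where

  slices-saturated⇒saturated : ∀ i →
    (∀ t → Saturated (Slice U t) i) → Saturated U (inject₁ i)
  slices-saturated⇒saturated i sat x =
    Sum.map (U-resp (init-∷ʳ-last x)) (Sum.map (lift one₃) (lift two₃)) (sat (last x) (init x))
    where
    lift : ∀ c → Slice U (last x) (addAt (init x) i c) → U (addAt x (inject₁ i) c)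
    lift c = U-resp λ k → trans (sym (addAt-∷ʳ-inject₁ (init x) (last x) i c k))
                                (addAt-cong (inject₁ i) c (init-∷ʳ-last x) k)

  saturated⇒slices-saturated : ∀ i → Saturated U (inject₁ i) → ∀ t → Saturated (Slice U t) i
  saturated⇒slices-saturated i sat t y =
    Sum.map id (Sum.map (lower one₃) (lower two₃)) (sat (y ∷ʳ t))
    where
    lower : ∀ c → U (addAt (y ∷ʳ t) (inject₁ i) c) → Slice U t (addAt y i c)
    lower c = U-resp (addAt-∷ʳ-inject₁ y t i c)

  saturated-last⇒slices-cover : Saturated U (fromℕ n) → Universal (⋃ Z3 (Slice U))
  saturated-last⇒slices-cover sat y =
    [ (zero ,_) , [ (one₃ ,_) ∘ lower one₃ , (two₃ ,_) ∘ lower two₃ ]′ ]′ (sat (y ∷ʳ zero))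
    where
    lower : ∀ c → U (addAt (y ∷ʳ zero) (fromℕ n) c) → Slice U c y
    lower c = U-resp (addAt-∷ʳ-last y zero c)

  slices-cover⇒saturated-last : Universal (⋃ Z3 (Slice U)) → Saturated U (fromℕ n)
  slices-cover⇒saturated-last cover x with cover (init x)
  ... | t , u = Sum.map at-x (Sum.map (at one₃) (at two₃)) (+₃-reach (last x) t)
    where
    at-x : t ≡ last x → U x
    at-x refl = U-resp (init-∷ʳ-last x) u
    at : ∀ c → t ≡ last x +₃ c → U (addAt x (fromℕ n) c)
    at c refl = U-resp (λ k → trans (sym (addAt-∷ʳ-last (init x) (last x) c k))
                                    (addAt-cong (fromℕ n) c (init-∷ʳ-last x) k)) u

sum3-cong : ∀ {n} {x y : Vec3 n} → x ≗ y → sum3 x ≡ sum3 y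
sum3-cong {ℕ.zero} x≗y = refl
sum3-cong {suc n}  x≗y = cong₂ _+₃_ (x≗y zero) (sum3-cong (x≗y ∘ suc))

sum3-replicate-zero : ∀ n → sum3 (replicate n zero) ≡ zero
sum3-replicate-zero ℕ.zero  = refl
sum3-replicate-zero (suc n) = sum3-replicate-zero n

sum3-∷ʳ : ∀ {n} (xs : Vec3 n) v → sum3 (xs ∷ʳ v) ≡ sum3 xs +₃ v
sum3-∷ʳ {ℕ.zero} xs v = +₃-identityʳ v
sum3-∷ʳ {suc n}  xs v = begin
  xs zero +₃ sum3 (xs ∘ suc ∷ʳ v)     ≡⟨ cong (xs zero +₃_) (sum3-∷ʳ (xs ∘ suc) v) ⟩
  xs zero +₃ (sum3 (xs ∘ suc) +₃ v)   ≡⟨ +₃-assoc (xs zero) _ v ⟨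
  (xs zero +₃ sum3 (xs ∘ suc)) +₃ v   ∎
  where open ≡-Reasoning

sum3-addAt : ∀ {n} (x : Vec3 n) i c → sum3 (addAt x i c) ≡ sum3 x +₃ c
sum3-addAt {suc n} x zero c = begin
  (x zero +₃ c) +₃ s   ≡⟨ +₃-assoc (x zero) c s ⟩
  x zero +₃ (c +₃ s)   ≡⟨ cong (x zero +₃_) (+₃-comm c s) ⟩
  x zero +₃ (s +₃ c)   ≡⟨ +₃-assoc (x zero) s c ⟨
  (x zero +₃ s) +₃ c   ∎
  where open ≡-Reasoning
        s = sum3 (x ∘ suc)
sum3-addAt {suc n} x (suc i) c = begin
  x zero +₃ sum3 (addAt (x ∘ suc) i c)   ≡⟨ cong (x zero +₃_) (sum3-addAt (x ∘ suc) i c) ⟩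
  x zero +₃ (sum3 (x ∘ suc) +₃ c)        ≡⟨ +₃-assoc (x zero) _ c ⟨
  (x zero +₃ sum3 (x ∘ suc)) +₃ c        ∎
  where open ≡-Reasoning

A-respects : ∀ {n} → A n Respects _≗_
A-respects x≗y a = trans (sym (sum3-cong x≗y)) a

A-saturated : ∀ {n} i → Saturated (A n) i
A-saturated i x with sum3 x | sum3-addAt x i one₃ | sum3-addAt x i two₃
... | zero             | _   | _   = inj₁ refl
... | suc zero         | _   | s+2 = inj₂ (inj₂ s+2)
... | suc (suc zero)   | s+1 | _   = inj₂ (inj₁ s+1)

Dset-respects : ∀ m → Dset m Respects _≗_
Dset-respects ℕ.zero  x≗y x≢0 = x≢0 ∘ trans (x≗y zero)
Dset-respects (suc m) {x} {y} x≗y =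
  Sum.map (on-layer (Dset-respects m)) (Sum.map (on-layer A-respects) (on-layer A-respects))
  where
  on-layer : ∀ {P : Subset3 (suc m)} {c} → P Respects _≗_ →
             P (init x) × last x ≡ c → P (init y) × last y ≡ c
  on-layer P-resp (p , e) = P-resp (x≗y ∘ inject₁) p , trans (sym (x≗y _)) e

module _ {m : ℕ} where

  Dset⊆slice-zero : Dset m ⊆ Slice (Dset (suc m)) zero
  Dset⊆slice-zero {y} d = inj₁ (Dset-respects m (sym ∘ init-∷ʳ y zero) d , last-∷ʳ y zero)

  A⊆slice-suc : ∀ t → A (suc m) ⊆ Slice (Dset (suc m)) (suc t)
  A⊆slice-suc zero       {y} a =
    inj₂ (inj₁ (A-respects (sym ∘ init-∷ʳ y one₃) a , last-∷ʳ y one₃))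
  A⊆slice-suc (suc zero) {y} a =
    inj₂ (inj₂ (A-respects (sym ∘ init-∷ʳ y two₃) a , last-∷ʳ y two₃))

  slice-zero⊆Dset : Slice (Dset (suc m)) zero ⊆ Dset m
  slice-zero⊆Dset {y} (inj₁ (d , _)) = Dset-respects m (init-∷ʳ y zero) d
  slice-zero⊆Dset {y} (inj₂ (inj₁ (_ , e))) = contradiction (trans (sym (last-∷ʳ y zero)) e) 0≢1+n
  slice-zero⊆Dset {y} (inj₂ (inj₂ (_ , e))) = contradiction (trans (sym (last-∷ʳ y zero)) e) 0≢1+n

  slice-suc⊆A : ∀ {t} → Slice (Dset (suc m)) (suc t) ⊆ A (suc m)
  slice-suc⊆A {t} {y} (inj₁ (_ , e)) = contradiction (trans (sym e) (last-∷ʳ y (suc t))) 0≢1+n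
  slice-suc⊆A {t} {y} (inj₂ (inj₁ (a , _))) = A-respects (init-∷ʳ y (suc t)) a
  slice-suc⊆A {t} {y} (inj₂ (inj₂ (a , _))) = A-respects (init-∷ʳ y (suc t)) a

  Dset-saturated-inject₁ : ∀ i → Saturated (Dset m) i → Saturated (Dset (suc m)) (inject₁ i)
  Dset-saturated-inject₁ i sat = slices-saturated⇒saturated (Dset-respects (suc m)) i λ where
    zero    → saturated-mono i Dset⊆slice-zero sat
    (suc t) → saturated-mono i (A⊆slice-suc t) (A-saturated i)

  Dset-unsaturated-inject₁ : ∀ i → ¬ Saturated (Dset m) i → ¬ Saturated (Dset (suc m)) (inject₁ i)
  Dset-unsaturated-inject₁ i unsat sat = unsat (saturated-mono i slice-zero⊆Dset slice-zero-saturated)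
    where
    slice-zero-saturated : Saturated (Slice (Dset (suc m)) zero) i
    slice-zero-saturated = saturated⇒slices-saturated (Dset-respects (suc m)) i sat zero

  Dset-saturated-last⇔ : Saturated (Dset (suc m)) (fromℕ (suc m)) ⇔ Universal (Dset m ∪ A (suc m))
  Dset-saturated-last⇔ = mk⇔
    (λ sat y → slice⊆Dset∪A (saturated-last⇒slices-cover (Dset-respects (suc m)) sat y))
    (λ cover → slices-cover⇒saturated-last (Dset-respects (suc m)) (λ y → Dset∪A⊆slices (cover y)))
    where
    slice⊆Dset∪A : ⋃ Z3 (Slice (Dset (suc m))) ⊆ Dset m ∪ A (suc m)
    slice⊆Dset∪A (zero  , d) = inj₁ (slice-zero⊆Dset d)
    slice⊆Dset∪A (suc t , d) = inj₂ (slice-suc⊆A d)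
    Dset∪A⊆slices : Dset m ∪ A (suc m) ⊆ ⋃ Z3 (Slice (Dset (suc m)))
    Dset∪A⊆slices (inj₁ d) = zero , Dset⊆slice-zero d
    Dset∪A⊆slices (inj₂ a) = one₃ , A⊆slice-suc zero a

D₁-saturated : Saturated (Dset 0) zero
D₁-saturated x with x zero
... | zero  = inj₂ (inj₁ λ ())
... | suc _ = inj₁ λ ()

D₁∪A₁-universal : Universal (Dset 0 ∪ A 1)
D₁∪A₁-universal y with y zero
... | zero  = inj₂ refl
... | suc _ = inj₁ λ ()

Dset∪A-not-universal : ∀ m → ¬ Universal (Dset (suc m) ∪ A (suc (suc m)))
Dset∪A-not-universal m universal = [ y∉Dset , y∉A ]′ (universal y)
  where
  e : Vec3 (suc m)
  e = replicate m zero ∷ʳ one₃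
  y : Vec3 (suc (suc m))
  y = e ∷ʳ one₃
  sum-e : sum3 e ≡ one₃
  sum-e = trans (sum3-∷ʳ (replicate m zero) one₃) (cong (_+₃ one₃) (sum3-replicate-zero m))
  y∉Dset : ¬ Dset (suc m) y
  y∉Dset d = 0≢1+n (trans (sym (slice-suc⊆A d)) sum-e)
  y∉A : ¬ A (suc (suc m)) y
  y∉A a = 0≢1+n (trans (sym a) (trans (sum3-∷ʳ e one₃) (cong (_+₃ one₃) sum-e)))

Dset-saturated-zero : ∀ m → Saturated (Dset m) zero
Dset-saturated-zero ℕ.zero  = D₁-saturated
Dset-saturated-zero (suc m) = Dset-saturated-inject₁ zero (Dset-saturated-zero m)

Dset-saturated-one : ∀ m → Saturated (Dset (suc m)) (suc zero)
Dset-saturated-one ℕ.zero  = from Dset-saturated-last⇔ D₁∪A₁-universal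
Dset-saturated-one (suc m) = Dset-saturated-inject₁ (suc zero) (Dset-saturated-one m)

Dset-unsaturated : ∀ m (i : Fin (suc (suc m))) → 2 ≤ toℕ i → ¬ Saturated (Dset (suc m)) i
Dset-unsaturated ℕ.zero  zero       ()
Dset-unsaturated ℕ.zero  (suc zero) (s≤s ())
Dset-unsaturated (suc m) i 2≤i with view i
... | ‵fromℕ     = Dset∪A-not-universal m ∘ to Dset-saturated-last⇔
... | ‵inject₁ j =
  Dset-unsaturated-inject₁ j (Dset-unsaturated m j (subst (2 ≤_) (toℕ-inject₁ j) 2≤i))

corollary3p5 : (m : ℕ) →
    Saturated (Dn (suc (suc m))) zero
    × Saturated (Dn (suc (suc m))) (suc zero)
    × ((i : Fin (suc (suc m))) → 2 ≤ toℕ i → ¬ Saturated (Dn (suc (suc m))) i)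
corollary3p5 m = Dset-saturated-zero (suc m) , Dset-saturated-one m , Dset-unsaturated m
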